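{- Let $\alpha>0$, let $G=(V,E)$ be an $\alpha$-expander on $n$ vertices and let $W\subseteq V$ be a vertex set such that $|W|>n/2$ and $|N_{G}(W)|\leq\alpha\epsilon n$, where $0<\epsilon<1/4$. Then there is a vertex set $U\subseteq W$ of size $|U|>\left(\frac{1}{2}-2\epsilon\right)n$ such that $G[U]$ is a $\left(\left(\frac{1}{2}-2\epsilon\right)n,\frac{\alpha}{2}\right)$-expander.
   Context: All graphs are finite and simple. For a graph $G=(V,E)$ and $U\subseteq V$, $N_G(U)=\{v\in V\setminus U: v \text{ has a neighbor in } U\}$. For $\alpha>0$, a graph $G$ on $n$ vertices is an $\alpha$-expander if $|N_G(U)|\geq \alpha|U|$ for every $U\subseteq V$ with $|U|\leq\lceil n/2\rceil$. For $k>0$, $G$ is a $(k,\alpha)$-expander if $|N_G(U)|\geq\alpha|U|$ for every $U\subseteq V$ with $|U|\leq k$. $G[U]$ is the induced subgraph on $U$.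
   Formalization: The parameters α and ε range over the rationals. -}

module Defs where

open import Data.Bool using (Bool; true; false; _∧_; not; T)
open import Data.Nat as ℕ using (ℕ; zero; suc)
open import Data.Fin using (Fin)
open import Data.Fin.Subset using (Subset; _⊆_; ∣_∣; _∩_; inside; outside)
open import Data.Vec using (Vec; lookup; tabulate; foldr)
open import Data.Bool.ListAction using (any)
open import Data.List.Base using (allFin)
open import Data.Rational using (ℚ; _≤_; _*_; _/_)
open import Data.Integer using (+_)
open import Relation.Binary.PropositionalEquality using (_≡_)

record Graph (n : ℕ) : Set where
  field
    adj   : Fin n → Fin n → Bool
    sym   : ∀ u v → adj u v ≡ adj v u
    irrefl : ∀ v → adj v v ≡ false

open Graph public

isIn : ∀ {n} → Subset n → Fin n → Bool
isIn U v with lookup U v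
... | inside  = true
... | outside = false

fromBool : Bool → Data.Fin.Subset.Side
fromBool true  = inside
fromBool false = outside

N : ∀ {n} → Graph n → Subset n → Subset n
N {n} G U = tabulate λ v →
  fromBool (not (isIn U v) ∧ any (λ u → isIn U u ∧ adj G u v) (allFin n))

ℕtoℚ : ℕ → ℚ
ℕtoℚ m = (+ m) / 1

IsExpander : ∀ {n} → Graph n → ℚ → Set
IsExpander {n} G α =
  ∀ (U : Subset n) → ∣ U ∣ ℕ.≤ ℕ.⌈ n /2⌉ → α * ℕtoℚ ∣ U ∣ ≤ ℕtoℚ ∣ N G U ∣

-- The induced subgraph G[W] is a (k,α)-expander.  We identify the vertex set
-- of G[W] with W ⊆ Fin n: for X ⊆ W, N_{G[W]}(X) = N_G(X) ∩ W.
InducedIsKExpander : ∀ {n} → Graph n → Subset n → ℚ → ℚ → Set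
InducedIsKExpander {n} G W k α =
  ∀ (X : Subset n) → X ⊆ W → ℕtoℚ ∣ X ∣ ≤ k →
    α * ℕtoℚ ∣ X ∣ ≤ ℕtoℚ ∣ N G X ∩ W ∣

-- Peel off from W, one at a time, sets X ⊆ U = W ∖ S with |X| ≤ (1/2 − 2ε)n that expand
-- poorly in G[U] (|N(X) ∩ U| < (α/2)|X|), collecting them in S.  Then S keeps at most
-- (α/2)|S| neighbours inside W, so as long as |S| ≤ n/2 expansion of G gives
-- α|S| ≤ |N(S)| ≤ (α/2)|S| + |N(W)| ≤ (α/2)|S| + αεn, i.e. |S| ≤ 2εn; hence adding the next
-- piece keeps |S| ≤ 2εn + (1/2 − 2ε)n = n/2 and the bound persists.  When nothing is left
-- to peel, U is the required set, as |U| ≥ |W| − 2εn.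

module Submission where

open import Defs hiding (sym)
open import Data.Nat using (ℕ)
open import Data.Fin.Subset using (Subset; _⊆_; ∣_∣)
open import Data.Product using (Σ; _×_)
open import Data.Rational using (ℚ; _<_; _≤_; _*_; _-_; 0ℚ; ½)

open import Data.Bool using (true; false; _∧_; not; T)
open import Data.Bool.Properties using (T-≡; T-∧; T-not-≡)
open import Data.Bool.ListAction using (any)
open import Data.Empty using (⊥-elim)
open import Data.Fin using (zero; suc)
open import Data.Fin.Subset
  using (_∈_; _∉_; _∩_; _∪_; _─_; Nonempty; Empty; inside; outside) renaming (⊥ to ∅)
open import Data.Fin.Subset.Properties
  using ( x∈p∩q⁺; x∈p∩q⁻; x∈p∪q⁺; x∈p∪q⁻; x∈p∧x∉q⇒x∈p─q; p─q⊆p; p⊆q⇒∣p∣≤∣q∣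
        ; ∣p─q∣≤∣p∣; p─q─r≡p─q∪r; p∩q≢∅⇒∣p─q∣<∣p∣; ⊥⊆; ∉⊥; ∣⊥∣≡0; ∩-zeroˡ; Empty-unique
        ; nonempty?; anySubset?; _⊆?_; _∈?_)
import Data.Integer as ℤ
import Data.Integer.Properties as ℤ
open import Data.List.Base using (allFin)
open import Data.List.Relation.Unary.Any using (satisfied)
open import Data.List.Relation.Unary.Any.Properties using (any⁺; any⁻; tabulate⁺)
import Data.Nat as ℕ
import Data.Nat.Properties as ℕ
import Data.Nat.Coprimality as Coprime
open import Data.Product as Product using (∃-syntax; _,_)
open import Data.Rational using (mkℚ; _+_; -_; *≤*; nonNegative; positive)
open import Data.Rational.Properties
  using ( normalize-coprime; drop-*≤*; ≤-refl; <⇒≤; ≰⇒>; _≤?_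
        ; +-mono-≤; +-monoˡ-≤; +-monoʳ-≤; +-monoʳ-<; *-monoˡ-≤-nonNeg; *-monoʳ-≤-nonNeg
        ; *-cancelˡ-≤-pos; *-distribˡ-+; *-zeroʳ; module ≤-Reasoning)
open import Data.Rational.Solver using (module +-*-Solver)
open import Data.Sum using (inj₁; inj₂; [_,_]′)
open import Data.Vec using ([]; _∷_; here; there; lookup)
open import Data.Vec.Properties using (lookup∘tabulate; []=⇒lookup; lookup⇒[]=)
open import Function using (_∘_; _⇔_; mk⇔; Equivalence)
open import Relation.Nullary using (¬_; Dec; yes; no; ¬?)
open import Relation.Nullary.Decidable using (_×-dec_; decidable-stable)
open import Relation.Binary.PropositionalEquality
  using (_≡_; refl; sym; trans; cong; subst; subst₂)

open +-*-Solver using (solve; _:+_; _:*_; _:-_; :-_; con; _:=_)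
open Equivalence using (to; from)

private variable n : ℕ

ℕtoℚ≡mkℚ : ∀ m → ℕtoℚ m ≡ mkℚ (ℤ.+ m) 0 (Coprime.sym (Coprime.1-coprimeTo m))
ℕtoℚ≡mkℚ m = normalize-coprime (Coprime.sym (Coprime.1-coprimeTo m))

ℕtoℚ-homo-+ : ∀ a b → ℕtoℚ (a ℕ.+ b) ≡ ℕtoℚ a + ℕtoℚ b
ℕtoℚ-homo-+ a b
  rewrite ℕtoℚ≡mkℚ a | ℕtoℚ≡mkℚ b | ℤ.*-identityʳ (ℤ.+ a) | ℤ.*-identityʳ (ℤ.+ b) = refl

ℕtoℚ-mono-≤ : ∀ {a b} → a ℕ.≤ b → ℕtoℚ a ≤ ℕtoℚ b
ℕtoℚ-mono-≤ {a} {b} a≤b rewrite ℕtoℚ≡mkℚ a | ℕtoℚ≡mkℚ b =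
  *≤* (subst₂ ℤ._≤_ (sym (ℤ.*-identityʳ (ℤ.+ a))) (sym (ℤ.*-identityʳ (ℤ.+ b))) (ℤ.+≤+ a≤b))

ℕtoℚ-cancel-≤ : ∀ {a b} → ℕtoℚ a ≤ ℕtoℚ b → a ℕ.≤ b
ℕtoℚ-cancel-≤ {a} {b} a≤b rewrite ℕtoℚ≡mkℚ a | ℕtoℚ≡mkℚ b with drop-*≤* a≤b
... | a*1≤b*1 rewrite ℤ.*-identityʳ (ℤ.+ a) | ℤ.*-identityʳ (ℤ.+ b) = ℤ.drop‿+≤+ a*1≤b*1

0≤ℕtoℚ : ∀ m → 0ℚ ≤ ℕtoℚ m
0≤ℕtoℚ m = ℕtoℚ-mono-≤ {b = m} ℕ.z≤n

ℕtoℚ-≤-+ : ∀ {a} b c → a ℕ.≤ b ℕ.+ c → ℕtoℚ a ≤ ℕtoℚ b + ℕtoℚ c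
ℕtoℚ-≤-+ b c a≤b+c = subst (_ ≤_) (ℕtoℚ-homo-+ b c) (ℕtoℚ-mono-≤ a≤b+c)

½*n≤⌈n/2⌉ : ∀ n → ½ * ℕtoℚ n ≤ ℕtoℚ ℕ.⌈ n /2⌉
½*n≤⌈n/2⌉ n = begin
  ½ * ℕtoℚ n                ≤⟨ *-monoˡ-≤-nonNeg ½ (ℕtoℚ-≤-+ m m n≤m+m) ⟩
  ½ * (ℕtoℚ m + ℕtoℚ m)     ≡⟨ solve 1 (λ x → con ½ :* (x :+ x) := x) refl (ℕtoℚ m) ⟩
  ℕtoℚ m                    ∎
  where
  open ≤-Reasoning
  m = ℕ.⌈ n /2⌉
  n≤m+m : n ℕ.≤ m ℕ.+ m
  n≤m+m = subst (ℕ._≤ m ℕ.+ m) (ℕ.⌊n/2⌋+⌈n/2⌉≡n n) (ℕ.+-monoˡ-≤ m (ℕ.⌊n/2⌋≤⌈n/2⌉ n))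

-r+[r+p]≡p : ∀ r p → - r + (r + p) ≡ p
-r+[r+p]≡p = solve 2 (λ r p → :- r :+ (r :+ p) := p) refl

+-cancelˡ-≤ : ∀ r {p q} → r + p ≤ r + q → p ≤ q
+-cancelˡ-≤ r {p} {q} r+p≤r+q =
  subst₂ _≤_ (-r+[r+p]≡p r p) (-r+[r+p]≡p r q) (+-monoʳ-≤ (- r) r+p≤r+q)

+-cancelˡ-< : ∀ r {p q} → r + p < r + q → p < q
+-cancelˡ-< r {p} {q} r+p<r+q =
  subst₂ _<_ (-r+[r+p]≡p r p) (-r+[r+p]≡p r q) (+-monoʳ-< (- r) r+p<r+q)

x∈p─q⇒x∉q : ∀ {p q : Subset n} {x} → x ∈ p ─ q → x ∉ q
x∈p─q⇒x∉q {p = _ ∷ _} {inside  ∷ _} ()        here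
x∈p─q⇒x∉q {p = _ ∷ _} {outside ∷ _} here      ()
x∈p─q⇒x∉q {p = _ ∷ _} {_       ∷ _} (there x∈) (there x∈q) = x∈p─q⇒x∉q x∈ x∈q

q⊆r─p⇒Empty[p∩q] : ∀ {p q r : Subset n} → q ⊆ r ─ p → Empty (p ∩ q)
q⊆r─p⇒Empty[p∩q] q⊆r─p (x , x∈p∩q) with x∈p∩q⁻ _ _ x∈p∩q
... | x∈p , x∈q = x∈p─q⇒x∉q (q⊆r─p x∈q) x∈p

p⊆q∪[p─q] : ∀ (p q : Subset n) → p ⊆ q ∪ (p ─ q)
p⊆q∪[p─q] p q {x} x∈p with x ∈? q
... | yes x∈q = x∈p∪q⁺ (inj₁ x∈q)
... | no  x∉q = x∈p∪q⁺ (inj₂ (x∈p∧x∉q⇒x∈p─q x∈p x∉q))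

∣p─q∪r∣<∣p─q∣ : ∀ {p q r : Subset n} → r ⊆ p ─ q → Nonempty r → ∣ p ─ (q ∪ r) ∣ ℕ.< ∣ p ─ q ∣
∣p─q∪r∣<∣p─q∣ {p = p} {q} {r} r⊆p─q (x , x∈r) =
  subst (λ s → ∣ s ∣ ℕ.< ∣ p ─ q ∣) (p─q─r≡p─q∪r p q r)
        (p∩q≢∅⇒∣p─q∣<∣p∣ (p ─ q) r (x , x∈p∩q⁺ (r⊆p─q x∈r , x∈r)))

∣p∪q∣≤∣p∣+∣q∣ : ∀ (p q : Subset n) → ∣ p ∪ q ∣ ℕ.≤ ∣ p ∣ ℕ.+ ∣ q ∣
∣p∪q∣≤∣p∣+∣q∣ []            []            = ℕ.z≤n
∣p∪q∣≤∣p∣+∣q∣ (inside  ∷ p) (inside  ∷ q) =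
  ℕ.s≤s (ℕ.≤-trans (∣p∪q∣≤∣p∣+∣q∣ p q) (ℕ.+-monoʳ-≤ ∣ p ∣ (ℕ.n≤1+n ∣ q ∣)))
∣p∪q∣≤∣p∣+∣q∣ (inside  ∷ p) (outside ∷ q) = ℕ.s≤s (∣p∪q∣≤∣p∣+∣q∣ p q)
∣p∪q∣≤∣p∣+∣q∣ (outside ∷ p) (inside  ∷ q) =
  subst (ℕ.suc ∣ p ∪ q ∣ ℕ.≤_) (sym (ℕ.+-suc ∣ p ∣ ∣ q ∣)) (ℕ.s≤s (∣p∪q∣≤∣p∣+∣q∣ p q))
∣p∪q∣≤∣p∣+∣q∣ (outside ∷ p) (outside ∷ q) = ∣p∪q∣≤∣p∣+∣q∣ p q

∣p∪q∣≡∣p∣+∣q∣ : ∀ (p q : Subset n) → Empty (p ∩ q) → ∣ p ∪ q ∣ ≡ ∣ p ∣ ℕ.+ ∣ q ∣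
∣p∪q∣≡∣p∣+∣q∣ []            []            _ = refl
∣p∪q∣≡∣p∣+∣q∣ (inside  ∷ p) (inside  ∷ q) d = ⊥-elim (d (zero , here))
∣p∪q∣≡∣p∣+∣q∣ (inside  ∷ p) (outside ∷ q) d =
  cong ℕ.suc (∣p∪q∣≡∣p∣+∣q∣ p q (d ∘ Product.map suc there))
∣p∪q∣≡∣p∣+∣q∣ (outside ∷ p) (inside  ∷ q) d =
  trans (cong ℕ.suc (∣p∪q∣≡∣p∣+∣q∣ p q (d ∘ Product.map suc there))) (sym (ℕ.+-suc ∣ p ∣ ∣ q ∣))
∣p∪q∣≡∣p∣+∣q∣ (outside ∷ p) (outside ∷ q) d = ∣p∪q∣≡∣p∣+∣q∣ p q (d ∘ Product.map suc there)

ℕtoℚ-∣p∣≤∣q∣+∣r∣ : ∀ {p q r : Subset n} → p ⊆ q ∪ r → ℕtoℚ ∣ p ∣ ≤ ℕtoℚ ∣ q ∣ + ℕtoℚ ∣ r ∣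
ℕtoℚ-∣p∣≤∣q∣+∣r∣ {q = q} {r} p⊆q∪r =
  ℕtoℚ-≤-+ ∣ q ∣ ∣ r ∣ (ℕ.≤-trans (p⊆q⇒∣p∣≤∣q∣ p⊆q∪r) (∣p∪q∣≤∣p∣+∣q∣ q r))

fromBool≡id : ∀ b → fromBool b ≡ b
fromBool≡id true  = refl
fromBool≡id false = refl

isIn≡lookup : ∀ (p : Subset n) x → isIn p x ≡ lookup p x
isIn≡lookup p x with lookup p x
... | inside  = refl
... | outside = refl

∈⇒T-isIn : ∀ {p : Subset n} {x} → x ∈ p → T (isIn p x)
∈⇒T-isIn {p = p} {x} x∈p = from T-≡ (trans (isIn≡lookup p x) ([]=⇒lookup x∈p))

T-isIn⇒∈ : ∀ {p : Subset n} {x} → T (isIn p x) → x ∈ p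
T-isIn⇒∈ {p = p} {x} t = lookup⇒[]= x p (trans (sym (isIn≡lookup p x)) (to T-≡ t))

∉⇒isIn≡false : ∀ {p : Subset n} {x} → x ∉ p → isIn p x ≡ false
∉⇒isIn≡false {p = p} {x} x∉p with isIn p x in eq
... | true  = ⊥-elim (x∉p (T-isIn⇒∈ (from T-≡ eq)))
... | false = refl

module _ (G : Graph n) where

  ∈N⇔ : ∀ {U v} →
        v ∈ N G U ⇔ T (not (isIn U v) ∧ any (λ u → isIn U u ∧ adj G u v) (allFin n))
  ∈N⇔ {U} {v} = mk⇔ (λ v∈NU → from T-≡ (trans (sym lookup-N) ([]=⇒lookup v∈NU)))
                    (λ t → lookup⇒[]= v (N G U) (trans lookup-N (to T-≡ t)))
    where lookup-N = trans (lookup∘tabulate _ v) (fromBool≡id _)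

  ∈N⁻ : ∀ {U v} → v ∈ N G U → v ∉ U × ∃[ u ] u ∈ U × T (adj G u v)
  ∈N⁻ {U} {v} v∈NU with to T-∧ (to (∈N⇔ {U} {v}) v∈NU)
  ... | v∉U , some-u with satisfied (any⁻ _ (allFin n) some-u)
  ... | u , uv with to T-∧ uv
  ... | u∈U , adj-uv =
    (λ v∈U → subst T (to T-not-≡ v∉U) (∈⇒T-isIn v∈U)) , u , T-isIn⇒∈ u∈U , adj-uv

  ∈N⁺ : ∀ {U u v} → v ∉ U → u ∈ U → T (adj G u v) → v ∈ N G U
  ∈N⁺ {U} {u} {v} v∉U u∈U adj-uv = from (∈N⇔ {U} {v}) (from T-∧
    (from T-not-≡ (∉⇒isIn≡false v∉U) , any⁺ _ (tabulate⁺ u (from T-∧ (∈⇒T-isIn u∈U , adj-uv)))))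

  N∅≡∅ : N G ∅ ≡ ∅
  N∅≡∅ = Empty-unique λ (_ , v∈N∅) → let _ , _ , u∈∅ , _ = ∈N⁻ v∈N∅ in ∉⊥ u∈∅

  N[p∪q]⊆Np∪Nq : ∀ p q → N G (p ∪ q) ⊆ N G p ∪ N G q
  N[p∪q]⊆Np∪Nq p q v∈N with ∈N⁻ v∈N
  ... | v∉p∪q , u , u∈p∪q , adj-uv with x∈p∪q⁻ p q u∈p∪q
  ... | inj₁ u∈p = x∈p∪q⁺ (inj₁ (∈N⁺ (v∉p∪q ∘ x∈p∪q⁺ ∘ inj₁) u∈p adj-uv))
  ... | inj₂ u∈q = x∈p∪q⁺ (inj₂ (∈N⁺ (v∉p∪q ∘ x∈p∪q⁺ ∘ inj₂) u∈q adj-uv))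

  N[p∪q]∩r⊆Np∩r∪Nq∩[r─p] : ∀ p q r → N G (p ∪ q) ∩ r ⊆ (N G p ∩ r) ∪ (N G q ∩ (r ─ p))
  N[p∪q]∩r⊆Np∩r∪Nq∩[r─p] p q r v∈ with x∈p∩q⁻ _ _ v∈
  ... | v∈N , v∈r with x∈p∪q⁻ _ _ (N[p∪q]⊆Np∪Nq p q v∈N)
  ... | inj₁ v∈Np = x∈p∪q⁺ (inj₁ (x∈p∩q⁺ (v∈Np , v∈r)))
  ... | inj₂ v∈Nq = x∈p∪q⁺ (inj₂ (x∈p∩q⁺ (v∈Nq , x∈p∧x∉q⇒x∈p─q v∈r v∉p)))
    where v∉p = Product.proj₁ (∈N⁻ v∈N) ∘ x∈p∪q⁺ ∘ inj₁

  p⊆q⇒Np⊆Np∩q∪Nq : ∀ {p q} → p ⊆ q → N G p ⊆ (N G p ∩ q) ∪ N G q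
  p⊆q⇒Np⊆Np∩q∪Nq {p} {q} p⊆q {v} v∈Np with v ∈? q
  ... | yes v∈q = x∈p∪q⁺ (inj₁ (x∈p∩q⁺ (v∈Np , v∈q)))
  ... | no  v∉q with ∈N⁻ v∈Np
  ...   | _ , u , u∈p , adj-uv = x∈p∪q⁺ (inj₂ (∈N⁺ v∉q (p⊆q u∈p) adj-uv))

FewNeighboursIn : Graph n → Subset n → ℚ → Subset n → Set
FewNeighboursIn G W h S = ℕtoℚ ∣ N G S ∩ W ∣ ≤ h * ℕtoℚ ∣ S ∣

FewNeighboursIn-∪ : ∀ (G : Graph n) {W S X} h → Empty (S ∩ X) →
  FewNeighboursIn G W h S → FewNeighboursIn G (W ─ S) h X → FewNeighboursIn G W h (S ∪ X)
FewNeighboursIn-∪ G {W} {S} {X} h S∩X≡∅ few-S few-X = begin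
  ℕtoℚ ∣ N G (S ∪ X) ∩ W ∣                         ≤⟨ ℕtoℚ-∣p∣≤∣q∣+∣r∣ (N[p∪q]∩r⊆Np∩r∪Nq∩[r─p] G S X W) ⟩
  ℕtoℚ ∣ N G S ∩ W ∣ + ℕtoℚ ∣ N G X ∩ (W ─ S) ∣   ≤⟨ +-mono-≤ few-S few-X ⟩
  h * ℕtoℚ ∣ S ∣ + h * ℕtoℚ ∣ X ∣                 ≡⟨ sym (*-distribˡ-+ h _ _) ⟩
  h * (ℕtoℚ ∣ S ∣ + ℕtoℚ ∣ X ∣)                   ≡⟨ cong (h *_) (sym ∣S∪X∣≡∣S∣+∣X∣) ⟩
  h * ℕtoℚ ∣ S ∪ X ∣                               ∎
  where
  open ≤-Reasoning
  ∣S∪X∣≡∣S∣+∣X∣ : ℕtoℚ ∣ S ∪ X ∣ ≡ ℕtoℚ ∣ S ∣ + ℕtoℚ ∣ X ∣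
  ∣S∪X∣≡∣S∣+∣X∣ = trans (cong ℕtoℚ (∣p∪q∣≡∣p∣+∣q∣ S X S∩X≡∅)) (ℕtoℚ-homo-+ ∣ S ∣ ∣ X ∣)

FewNeighboursIn⇒small : ∀ (G : Graph n) {α ε W T} → 0ℚ < α → IsExpander G α →
  ℕtoℚ ∣ N G W ∣ ≤ α * ε * ℕtoℚ n → T ⊆ W → ∣ T ∣ ℕ.≤ ℕ.⌈ n /2⌉ →
  FewNeighboursIn G W (½ * α) T → ℕtoℚ ∣ T ∣ ≤ ℕtoℚ 2 * ε * ℕtoℚ n
FewNeighboursIn⇒small {n} G {α} {ε} {W} {T} 0<α expander ∣NW∣≤αεn T⊆W ∣T∣≤⌈n/2⌉ few-T =
  *-cancelˡ-≤-pos α {{positive 0<α}} (begin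
    α * t                      ≡⟨ solve 2 (λ α t → α :* t := con (ℕtoℚ 2) :* (con ½ :* α :* t))
                                          refl α t ⟩
    ℕtoℚ 2 * (½ * α * t)       ≤⟨ *-monoˡ-≤-nonNeg (ℕtoℚ 2) {{nonNegative (0≤ℕtoℚ 2)}} ½αt≤αεn ⟩
    ℕtoℚ 2 * (α * ε * ℕtoℚ n)  ≡⟨ solve 3 (λ α ε n → con (ℕtoℚ 2) :* (α :* ε :* n)
                                                   := α :* (con (ℕtoℚ 2) :* ε :* n))
                                          refl α ε (ℕtoℚ n) ⟩
    α * (ℕtoℚ 2 * ε * ℕtoℚ n)  ∎)
  where
  open ≤-Reasoning
  t = ℕtoℚ ∣ T ∣
  αt≤½αt+αεn : α * t ≤ ½ * α * t + α * ε * ℕtoℚ n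
  αt≤½αt+αεn = begin
    α * t                                ≤⟨ expander T ∣T∣≤⌈n/2⌉ ⟩
    ℕtoℚ ∣ N G T ∣                       ≤⟨ ℕtoℚ-∣p∣≤∣q∣+∣r∣ (p⊆q⇒Np⊆Np∩q∪Nq G T⊆W) ⟩
    ℕtoℚ ∣ N G T ∩ W ∣ + ℕtoℚ ∣ N G W ∣  ≤⟨ +-mono-≤ few-T ∣NW∣≤αεn ⟩
    ½ * α * t + α * ε * ℕtoℚ n           ∎
  ½αt≤αεn : ½ * α * t ≤ α * ε * ℕtoℚ n
  ½αt≤αεn = +-cancelˡ-≤ (½ * α * t) (begin
    ½ * α * t + ½ * α * t       ≡⟨ solve 2 (λ α t → con ½ :* α :* t :+ con ½ :* α :* t := α :* t)
                                           refl α t ⟩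
    α * t                       ≤⟨ αt≤½αt+αεn ⟩
    ½ * α * t + α * ε * ℕtoℚ n  ∎)

¬h*∣X∣≤⇒Nonempty : ∀ h (X : Subset n) m → ¬ (h * ℕtoℚ ∣ X ∣ ≤ ℕtoℚ m) → Nonempty X
¬h*∣X∣≤⇒Nonempty {n} h X m h∣X∣≰m = decidable-stable (nonempty? X) λ X-empty →
  h∣X∣≰m (subst (_≤ ℕtoℚ m) (sym (h*∣X∣≡0 X-empty)) (0≤ℕtoℚ m))
  where
  h*∣X∣≡0 : Empty X → h * ℕtoℚ ∣ X ∣ ≡ 0ℚ
  h*∣X∣≡0 X-empty rewrite Empty-unique X-empty | ∣⊥∣≡0 n = *-zeroʳ h

module _ (G : Graph n) (W : Subset n) (k h : ℚ) (Inv : Subset n → Set)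
  (extend : ∀ {S X} → Inv S → X ⊆ W ─ S → ℕtoℚ ∣ X ∣ ≤ k →
            FewNeighboursIn G (W ─ S) h X → Inv (S ∪ X))
  where

  private
    Obstruction : Subset n → Subset n → Set
    Obstruction U X = X ⊆ U × ℕtoℚ ∣ X ∣ ≤ k × ¬ (h * ℕtoℚ ∣ X ∣ ≤ ℕtoℚ ∣ N G X ∩ U ∣)

    obstruction? : ∀ U X → Dec (Obstruction U X)
    obstruction? U X = X ⊆? U ×-dec (ℕtoℚ ∣ X ∣ ≤? k ×-dec ¬? (h * ℕtoℚ ∣ X ∣ ≤? ℕtoℚ ∣ N G X ∩ U ∣))

    peelFrom : ∀ m S → Inv S → ∣ W ─ S ∣ ℕ.< m →
               ∃[ S ] Inv S × InducedIsKExpander G (W ─ S) k h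
    peelWith : ∀ m S → Inv S → ∣ W ─ S ∣ ℕ.≤ m → Dec (∃[ X ] Obstruction (W ─ S) X) →
               ∃[ S ] Inv S × InducedIsKExpander G (W ─ S) k h

    peelFrom ℕ.zero    S inv ()
    peelFrom (ℕ.suc m) S inv ∣W─S∣<1+m =
      peelWith m S inv (ℕ.≤-pred ∣W─S∣<1+m) (anySubset? (obstruction? (W ─ S)))

    peelWith m S inv ∣W─S∣≤m (no ∄X) = S , inv , λ X X⊆W─S ∣X∣≤k →
      decidable-stable (h * ℕtoℚ ∣ X ∣ ≤? ℕtoℚ ∣ N G X ∩ (W ─ S) ∣)
        (λ X-expands-poorly → ∄X (X , X⊆W─S , ∣X∣≤k , X-expands-poorly))
    peelWith m S inv ∣W─S∣≤m (yes (X , X⊆W─S , ∣X∣≤k , X-expands-poorly)) =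
      peelFrom m (S ∪ X) (extend {S} {X} inv X⊆W─S ∣X∣≤k (<⇒≤ (≰⇒> X-expands-poorly)))
        (ℕ.<-≤-trans (∣p─q∪r∣<∣p─q∣ {p = W} {S} {X} X⊆W─S
                        (¬h*∣X∣≤⇒Nonempty h X ∣ N G X ∩ (W ─ S) ∣ X-expands-poorly))
                     ∣W─S∣≤m)

  peel : Inv ∅ → ∃[ S ] Inv S × InducedIsKExpander G (W ─ S) k h
  peel inv = peelFrom (ℕ.suc ∣ W ∣) ∅ inv (ℕ.s≤s (∣p─q∣≤∣p∣ W ∅))

2εx+[½-2ε]x≡½x : ∀ ε x → ℕtoℚ 2 * ε * x + (½ - ℕtoℚ 2 * ε) * x ≡ ½ * x
2εx+[½-2ε]x≡½x = solve 2 (λ ε x →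
  con (ℕtoℚ 2) :* ε :* x :+ (con ½ :- con (ℕtoℚ 2) :* ε) :* x := con ½ :* x) refl

∣W─S∣>[½-2ε]n : ∀ ε (W S : Subset n) → ½ * ℕtoℚ n < ℕtoℚ ∣ W ∣ →
  ℕtoℚ ∣ S ∣ ≤ ℕtoℚ 2 * ε * ℕtoℚ n → (½ - ℕtoℚ 2 * ε) * ℕtoℚ n < ℕtoℚ ∣ W ─ S ∣
∣W─S∣>[½-2ε]n {n} ε W S ½n<∣W∣ ∣S∣≤2εn = +-cancelˡ-< (ℕtoℚ 2 * ε * ℕtoℚ n) (begin-strict
  ℕtoℚ 2 * ε * ℕtoℚ n + (½ - ℕtoℚ 2 * ε) * ℕtoℚ n   ≡⟨ 2εx+[½-2ε]x≡½x ε (ℕtoℚ n) ⟩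
  ½ * ℕtoℚ n                                         <⟨ ½n<∣W∣ ⟩
  ℕtoℚ ∣ W ∣                                         ≤⟨ ℕtoℚ-∣p∣≤∣q∣+∣r∣ (p⊆q∪[p─q] W S) ⟩
  ℕtoℚ ∣ S ∣ + ℕtoℚ ∣ W ─ S ∣                        ≤⟨ +-monoˡ-≤ (ℕtoℚ ∣ W ─ S ∣) ∣S∣≤2εn ⟩
  ℕtoℚ 2 * ε * ℕtoℚ n + ℕtoℚ ∣ W ─ S ∣               ∎)
  where open ≤-Reasoning

Peelable : Graph n → Subset n → ℚ → ℚ → Subset n → Set
Peelable {n} G W α ε S =
  S ⊆ W × FewNeighboursIn G W (½ * α) S × ℕtoℚ ∣ S ∣ ≤ ℕtoℚ 2 * ε * ℕtoℚ n

Peelable-∅ : ∀ (G : Graph n) W α {ε} → 0ℚ ≤ ε → Peelable G W α ε ∅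
Peelable-∅ {n} G W α {ε} 0≤ε = ⊥⊆ , few-∅ , ∣∅∣≤2εn
  where
  open ≤-Reasoning
  few-∅ : FewNeighboursIn G W (½ * α) ∅
  few-∅ rewrite N∅≡∅ G | ∩-zeroˡ W | ∣⊥∣≡0 n | *-zeroʳ (½ * α) = ≤-refl
  ∣∅∣≤2εn : ℕtoℚ ∣ ∅ {n} ∣ ≤ ℕtoℚ 2 * ε * ℕtoℚ n
  ∣∅∣≤2εn rewrite ∣⊥∣≡0 n = begin
    0ℚ                       ≡⟨ solve 1 (λ n → con 0ℚ := con (ℕtoℚ 2) :* con 0ℚ :* n) refl (ℕtoℚ n) ⟩
    ℕtoℚ 2 * 0ℚ * ℕtoℚ n     ≤⟨ *-monoʳ-≤-nonNeg (ℕtoℚ n) {{nonNegative (0≤ℕtoℚ n)}}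
                                 (*-monoˡ-≤-nonNeg (ℕtoℚ 2) {{nonNegative (0≤ℕtoℚ 2)}} 0≤ε) ⟩
    ℕtoℚ 2 * ε * ℕtoℚ n      ∎

Peelable-∪ : ∀ (G : Graph n) {α ε W S X} → 0ℚ < α → IsExpander G α →
  ℕtoℚ ∣ N G W ∣ ≤ α * ε * ℕtoℚ n →
  Peelable G W α ε S → X ⊆ W ─ S → ℕtoℚ ∣ X ∣ ≤ (½ - ℕtoℚ 2 * ε) * ℕtoℚ n →
  FewNeighboursIn G (W ─ S) (½ * α) X → Peelable G W α ε (S ∪ X)
Peelable-∪ {n} G {α} {ε} {W} {S} {X} 0<α expander ∣NW∣≤αεn (S⊆W , few-S , ∣S∣≤2εn) X⊆W─S ∣X∣≤k few-X =
  S∪X⊆W , few-S∪X , FewNeighboursIn⇒small G 0<α expander ∣NW∣≤αεn S∪X⊆W ∣S∪X∣≤⌈n/2⌉ few-S∪X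
  where
  open ≤-Reasoning
  S∪X⊆W : S ∪ X ⊆ W
  S∪X⊆W = [ S⊆W , p─q⊆p W S ∘ X⊆W─S ]′ ∘ x∈p∪q⁻ S X
  few-S∪X : FewNeighboursIn G W (½ * α) (S ∪ X)
  few-S∪X = FewNeighboursIn-∪ G (½ * α) (q⊆r─p⇒Empty[p∩q] X⊆W─S) few-S few-X
  ∣S∪X∣≤⌈n/2⌉ : ∣ S ∪ X ∣ ℕ.≤ ℕ.⌈ n /2⌉
  ∣S∪X∣≤⌈n/2⌉ = ℕtoℚ-cancel-≤ (begin
    ℕtoℚ ∣ S ∪ X ∣                                     ≤⟨ ℕtoℚ-∣p∣≤∣q∣+∣r∣ {q = S} {X} (λ x∈S∪X → x∈S∪X) ⟩
    ℕtoℚ ∣ S ∣ + ℕtoℚ ∣ X ∣                            ≤⟨ +-mono-≤ ∣S∣≤2εn ∣X∣≤k ⟩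
    ℕtoℚ 2 * ε * ℕtoℚ n + (½ - ℕtoℚ 2 * ε) * ℕtoℚ n   ≡⟨ 2εx+[½-2ε]x≡½x ε (ℕtoℚ n) ⟩
    ½ * ℕtoℚ n                                         ≤⟨ ½*n≤⌈n/2⌉ n ⟩
    ℕtoℚ ℕ.⌈ n /2⌉                                     ∎)

lemma2p6 : (n : ℕ) (G : Graph n) (α ε : ℚ) (W : Subset n)
    → 0ℚ < α → IsExpander G α
    → ½ * ℕtoℚ n < ℕtoℚ ∣ W ∣
    → ℕtoℚ ∣ N G W ∣ ≤ α * ε * ℕtoℚ n
    → 0ℚ < ε → ε < ½ * ½
    → Σ (Subset n) λ U → U ⊆ W
    × ((½ - ℕtoℚ 2 * ε) * ℕtoℚ n < ℕtoℚ ∣ U ∣)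
    × InducedIsKExpander G U ((½ - ℕtoℚ 2 * ε) * ℕtoℚ n) (½ * α)
-- ε < 1/4 only makes the statement non-vacuous; the proof does not need it.
lemma2p6 n G α ε W 0<α expander ½n<∣W∣ ∣NW∣≤αεn 0<ε _ =
  let S , (_ , _ , ∣S∣≤2εn) , G[W─S]-expands =
        peel G W ((½ - ℕtoℚ 2 * ε) * ℕtoℚ n) (½ * α) (Peelable G W α ε)
             (Peelable-∪ G 0<α expander ∣NW∣≤αεn) (Peelable-∅ G W α (<⇒≤ 0<ε))
  in W ─ S , p─q⊆p W S , ∣W─S∣>[½-2ε]n ε W S ½n<∣W∣ ∣S∣≤2εn , G[W─S]-expands
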